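{- Let $(R,\mathfrak{m})$ be a finite commutative local ring with identity, with $m=|\mathfrak{m}|$ and residue field $R/\mathfrak{m}\simeq\mathbb{F}_q$. Let $k\in\mathbb{N}$ be such that $(k,q-1)\mid\frac{q-1}{2}$. If $(k,q)=1$, then $$\omega(G_R(k))=\omega(\Gamma(k,q)).$$
   Context: For a finite commutative ring $R$ with identity and $k\in\mathbb{N}$, let $U_R(k)=\{x^k : x\in R^*\}$ and let $G_R(k)=\mathrm{Cay}(R,U_R(k))$ be the Cayley graph with vertex set $R$, where $v,w$ are joined when $w-v\in U_R(k)$ (undirected under the stated hypotheses). The generalized Paley graph is $\Gamma(k,q)=\mathrm{Cay}(\mathbb{F}_q,\{x^k : x\in\mathbb{F}_q^*\})$. $\omega(H)$ denotes the clique number of a graph $H$ (the largest size of a complete subgraph). $(a,b)$ denotes the greatest common divisor. -}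

module Defs where

open import Level using (0ℓ)
open import Data.Nat using (ℕ; zero; suc; _≤_)
open import Data.Fin using (Fin)
open import Data.Product using (Σ; ∃; _×_)
open import Relation.Nullary using (¬_)
open import Relation.Binary.PropositionalEquality using (_≡_)
open import Relation.Unary using (Pred; _∈_; _∉_)
open import Function.Bundles using (_⇔_)
open import Algebra.Bundles using (CommutativeRing)
open import Algebra.Morphism.Structures using (module RingMorphisms)

CRing : Set₁
CRing = CommutativeRing 0ℓ 0ℓ

module _ (R : CRing) where
  open CommutativeRing R

  pow : Carrier → ℕ → Carrier
  pow x zero    = 1#
  pow x (suc k) = x * pow x k

  HasCard : ℕ → Set
  HasCard n = Σ (Fin n → Carrier) λ f →
                (∀ i j → f i ≈ f j → i ≡ j) × (∀ x → ∃ λ i → f i ≈ x)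

  IsUnit : Carrier → Set
  IsUnit x = ∃ λ y → x * y ≈ 1#

  InU : ℕ → Carrier → Set
  InU k z = ∃ λ x → IsUnit x × z ≈ pow x k

  -- adjacency in the Cayley graph G_R(k) = Cay(R, U_R(k))
  Adj : ℕ → Carrier → Carrier → Set
  Adj k v w = InU k (w - v)

  IsClique : ℕ → (n : ℕ) → (Fin n → Carrier) → Set
  IsClique k n f = ∀ i j → ¬ (i ≡ j) → (¬ (f i ≈ f j)) × Adj k (f i) (f j)

  CliqueNumberIs : ℕ → ℕ → Set
  CliqueNumberIs k w = (Σ (Fin w → Carrier) (IsClique k w))
                     × (∀ n (f : Fin n → Carrier) → IsClique k n f → n ≤ w)

  record IsIdeal (I : Pred Carrier 0ℓ) : Set where
    field
      resp : ∀ {x y} → x ≈ y → x ∈ I → y ∈ I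
      0∈   : 0# ∈ I
      +∈   : ∀ {x y} → x ∈ I → y ∈ I → (x + y) ∈ I
      *∈   : ∀ r {x} → x ∈ I → (r * x) ∈ I

  IsMaximalIdeal : Pred Carrier 0ℓ → Set₁
  IsMaximalIdeal I = IsIdeal I × (1# ∉ I) ×
    (∀ (J : Pred Carrier 0ℓ) → IsIdeal J → (∀ {x} → x ∈ I → x ∈ J) →
       (∀ {x} → x ∈ J → x ∈ I) Data.Sum.⊎ (1# ∈ J))
    where import Data.Sum

  IsLocalWith : Pred Carrier 0ℓ → Set₁
  IsLocalWith 𝔪 = IsMaximalIdeal 𝔪 ×
    (∀ (M : Pred Carrier 0ℓ) → IsMaximalIdeal M → ∀ x → (x ∈ M → x ∈ 𝔪) × (x ∈ 𝔪 → x ∈ M))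

IsField : CRing → Set
IsField F = ¬ (1# ≈ 0#) × (∀ x → ¬ (x ≈ 0#) → ∃ λ y → x * y ≈ 1#)
  where open CommutativeRing F

-- R/𝔪 ≃ F : a surjective ring homomorphism R → F with kernel exactly 𝔪
IsResidueMap : (R F : CRing) → Pred (CommutativeRing.Carrier R) 0ℓ →
               (CommutativeRing.Carrier R → CommutativeRing.Carrier F) → Set
IsResidueMap R F 𝔪 π =
    RingMorphisms.IsRingHomomorphism (CommutativeRing.rawRing R) (CommutativeRing.rawRing F) π
  × (∀ y → ∃ λ x → CommutativeRing._≈_ F (π x) y)
  × (∀ x → (CommutativeRing._≈_ F (π x) (CommutativeRing.0# F)) ⇔ (x ∈ 𝔪))

{-# OPTIONS --safe #-}

-- Reduction modulo 𝔪 sends a clique of G_R(k) to a clique of G_F(k) = Γ(k,q), because unit k-th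
-- powers stay nonzero unit k-th powers. Conversely a clique of G_F(k) lifts along any section of
-- R → F: since (k, q) = 1, k is invertible in F, and a Hensel-type argument shows that every z ∈ R
-- whose residue is a unit k-th power is itself a unit k-th power. So both graphs have cliques of
-- exactly the same sizes.

module Submission where

open import Level using (0ℓ)
open import Data.Nat as ℕ using (ℕ; zero; suc; _∸_)
import Data.Nat.Properties as ℕ
open import Data.Nat.Divisibility using (_∣_)
open import Data.Nat.GCD using (gcd; gcd-GCD; module Bézout)
open import Data.Fin as Fin using (Fin)
import Data.Fin.Properties as Finₚ
open import Data.Fin.Permutation using (Permutation′; permutation)
open import Data.Fin.Subset as Subset using (Subset; _⊃_)
open import Data.Fin.Subset.Induction using (⊃-wellFounded)
open import Data.Vec using (tabulate)
open import Data.Vec.Properties using (lookup∘tabulate; lookup⇒[]=; []=⇒lookup)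
open import Data.Product using (Σ; ∃; ∃₂; _×_; _,_; proj₁; proj₂)
open import Data.Sum using (_⊎_; inj₁; inj₂)
open import Data.Empty using (⊥-elim)
open import Function using (_∘_)
open import Function.Bundles using (_⇔_; mk⇔; Equivalence)
open import Induction.WellFounded using (Acc; acc)
open import Relation.Nullary using (¬_; Dec; yes; no; does)
open import Relation.Nullary.Decidable using (dec-true; decidable-stable)
open import Relation.Binary.PropositionalEquality as ≡ using (_≡_)
open import Relation.Unary using (Pred; _∈_; _∉_; _⊆_)
open import Algebra.Bundles using (CommutativeRing)
open import Algebra.Morphism.Structures using (module RingMorphisms)
import Algebra.Properties.Group
open import Defs

module Powers (R : CRing) where
  open CommutativeRing R
  open import Relation.Binary.Reasoning.Setoid setoid
  open import Algebra.Properties.Semiring.Mult semiring using (×-comm-*) renaming (_×_ to _·_)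
  open import Algebra.Properties.CommutativeSemigroup *-commutativeSemigroup
    using (interchange; x∙yz≈y∙xz)
  open import Algebra.Properties.Group +-group using (//-rightDividesˡ)

  pow-cong : ∀ k {x y} → x ≈ y → pow R x k ≈ pow R y k
  pow-cong zero    x≈y = refl
  pow-cong (suc k) x≈y = *-cong x≈y (pow-cong k x≈y)

  pow-distrib-* : ∀ x y k → pow R (x * y) k ≈ pow R x k * pow R y k
  pow-distrib-* x y zero    = sym (*-identityˡ 1#)
  pow-distrib-* x y (suc k) = trans (*-congˡ (pow-distrib-* x y k)) (interchange x y _ _)

  pow-1# : ∀ k → pow R 1# k ≈ 1#
  pow-1# zero    = refl
  pow-1# (suc k) = trans (*-identityˡ _) (pow-1# k)

  geom : Carrier → Carrier → ℕ → Carrier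
  geom x y zero    = 0#
  geom x y (suc k) = x * geom x y k + pow R y k

  geom-cong : ∀ k {x x′ y y′} → x ≈ x′ → y ≈ y′ → geom x y k ≈ geom x′ y′ k
  geom-cong zero    x≈x′ y≈y′ = refl
  geom-cong (suc k) x≈x′ y≈y′ = +-cong (*-cong x≈x′ (geom-cong k x≈x′ y≈y′)) (pow-cong k y≈y′)

  pow-expand : ∀ x y k → pow R x k ≈ pow R y k + (x - y) * geom x y k
  pow-expand x y zero    = sym (trans (+-congˡ (zeroʳ _)) (+-identityʳ 1#))
  pow-expand x y (suc k) = begin
    x * pow R x k                          ≈⟨ *-congˡ (pow-expand x y k) ⟩
    x * (yᵏ + d * s)                       ≈⟨ distribˡ x yᵏ (d * s) ⟩
    x * yᵏ + x * (d * s)                   ≈⟨ +-cong (*-congʳ y+d≈x) (x∙yz≈y∙xz d x s) ⟨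
    (y + d) * yᵏ + d * (x * s)             ≈⟨ +-congʳ (distribʳ yᵏ y d) ⟩
    (y * yᵏ + d * yᵏ) + d * (x * s)        ≈⟨ +-assoc _ _ _ ⟩
    y * yᵏ + (d * yᵏ + d * (x * s))        ≈⟨ +-congˡ (trans (distribˡ d (x * s) yᵏ) (+-comm _ _)) ⟨
    y * yᵏ + d * (x * s + yᵏ)              ∎
    where
    yᵏ d s : Carrier
    yᵏ = pow R y k
    d  = x - y
    s  = geom x y k
    y+d≈x : y + d ≈ x
    y+d≈x = trans (+-comm y d) (//-rightDividesˡ y x)

  geom-diag : ∀ y k → y * geom y y k ≈ k · pow R y k
  geom-diag y zero    = zeroʳ y
  geom-diag y (suc k) = begin
    y * (y * geom y y k + yᵏ)      ≈⟨ distribˡ _ _ _ ⟩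
    y * (y * geom y y k) + y * yᵏ  ≈⟨ +-congʳ (*-congˡ (geom-diag y k)) ⟩
    y * (k · yᵏ) + y * yᵏ          ≈⟨ +-congʳ (×-comm-* k y yᵏ) ⟩
    k · (y * yᵏ) + y * yᵏ          ≈⟨ +-comm _ _ ⟩
    y * yᵏ + k · (y * yᵏ)          ∎
    where
    yᵏ : Carrier
    yᵏ = pow R y k

module Units (R : CRing) where
  open CommutativeRing R
  open import Relation.Binary.Reasoning.Setoid setoid
  open Powers R using (pow-cong; pow-distrib-*; pow-1#)

  IsUnit-pow : ∀ k {x} → IsUnit R x → IsUnit R (pow R x k)
  IsUnit-pow k {x} (y , xy≈1) =
    pow R y k , trans (sym (pow-distrib-* x y k)) (trans (pow-cong k xy≈1) (pow-1# k))

  IsUnit-cancelʳ : ∀ {u d} → IsUnit R u → d * u ≈ 0# → d ≈ 0#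
  IsUnit-cancelʳ {u} {d} (v , uv≈1) du≈0 = begin
    d            ≈⟨ *-identityʳ d ⟨
    d * 1#       ≈⟨ *-congˡ uv≈1 ⟨
    d * (u * v)  ≈⟨ *-assoc d u v ⟨
    (d * u) * v  ≈⟨ *-congʳ du≈0 ⟩
    0# * v       ≈⟨ zeroˡ v ⟩
    0#           ∎

  IsUnit⇒≉0 : ¬ (1# ≈ 0#) → ∀ {x} → IsUnit R x → ¬ (x ≈ 0#)
  IsUnit⇒≉0 1≉0 (y , xy≈1) x≈0 = 1≉0 (trans (sym xy≈1) (trans (*-congʳ x≈0) (zeroˡ y)))

  InU-resp : ∀ {k z z′} → z ≈ z′ → InU R k z → InU R k z′
  InU-resp z≈z′ (x , x-unit , z≈xᵏ) = x , x-unit , trans (sym z≈z′) z≈xᵏ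

  InU⇒≉0 : ¬ (1# ≈ 0#) → ∀ {k z} → InU R k z → ¬ (z ≈ 0#)
  InU⇒≉0 1≉0 {k} (x , x-unit , z≈xᵏ) z≈0 =
    IsUnit⇒≉0 1≉0 (IsUnit-pow k x-unit) (trans (sym z≈xᵏ) z≈0)

module Characteristic (R : CRing) where
  open CommutativeRing R
  open import Relation.Binary.Reasoning.Setoid setoid
  open import Algebra.Properties.Semiring.Mult semiring using (×1-homo-*) renaming (_×_ to _·_)

  1+am≡bn⇒1≈0 : ∀ {m n} → m · 1# ≈ 0# → n · 1# ≈ 0# → ∀ a b → 1 ℕ.+ a ℕ.* m ≡ b ℕ.* n → 1# ≈ 0#
  1+am≡bn⇒1≈0 {m} {n} m≈0 n≈0 a b eq = begin
    1#                       ≈⟨ +-identityʳ 1# ⟨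
    1# + 0#                  ≈⟨ +-congˡ (multiple≈0 a m≈0) ⟨
    (1 ℕ.+ a ℕ.* m) · 1#     ≡⟨ ≡.cong (_· 1#) eq ⟩
    (b ℕ.* n) · 1#           ≈⟨ multiple≈0 b n≈0 ⟩
    0#                       ∎
    where
    multiple≈0 : ∀ c {l} → l · 1# ≈ 0# → (c ℕ.* l) · 1# ≈ 0#
    multiple≈0 c {l} l≈0 = trans (×1-homo-* c l) (trans (*-congˡ l≈0) (zeroʳ _))

  coprime-to-char⇒≉0 : ¬ (1# ≈ 0#) → ∀ {k m} → m · 1# ≈ 0# → gcd k m ≡ 1 → ¬ (k · 1# ≈ 0#)
  coprime-to-char⇒≉0 1≉0 {k} {m} m≈0 gcd≡1 k≈0
    with ≡.subst (λ d → Bézout.Identity d k m) gcd≡1 (Bézout.identity (gcd-GCD k m))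
  ... | Bézout.+- x y eq = 1≉0 (1+am≡bn⇒1≈0 m≈0 k≈0 y x eq)
  ... | Bézout.-+ x y eq = 1≉0 (1+am≡bn⇒1≈0 k≈0 m≈0 x y eq)

Fin-injective⇒surjective : ∀ {n} (φ : Fin n → Fin n) → (∀ i j → φ i ≡ φ j → i ≡ j) →
                           ∀ t → ∃ λ i → φ i ≡ t
Fin-injective⇒surjective {zero}  φ φ-inj ()
Fin-injective⇒surjective {suc m} φ φ-inj t with Finₚ.any? (λ i → φ i Fin.≟ t)
... | yes hit = hit
... | no miss with Finₚ.pigeonhole (ℕ.n<1+n m) (λ i → Fin.punchOut {i = t} (miss ∘ (i ,_) ∘ ≡.sym))
...   | i , j , i<j , eq = ⊥-elim (Finₚ.<-irrefl (φ-inj i j (Finₚ.punchOut-injective {i = t} _ _ eq)) i<j)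

module FiniteRing (R : CRing) {n} (card : HasCard R n) where
  open CommutativeRing R
  open import Relation.Binary.Reasoning.Setoid setoid
  open import Algebra.Properties.Semiring.Mult semiring using () renaming (_×_ to _·_)
  open import Algebra.Properties.CommutativeMonoid.Sum +-commutativeMonoid
    using (sum; sum-permute; ∑-distrib-+; sum-replicate; sum-cong-≋)
  open import Algebra.Properties.Group +-group using (∙-cancelˡ; ∙-cancelʳ)
  open import Data.Vec.Functional using (replicate)

  e : Fin n → Carrier
  e = proj₁ card

  e-injective : ∀ i j → e i ≈ e j → i ≡ j
  e-injective = proj₁ (proj₂ card)

  idx : Carrier → Fin n
  idx x = proj₁ (proj₂ (proj₂ card) x)

  e-idx : ∀ x → e (idx x) ≈ x
  e-idx x = proj₂ (proj₂ (proj₂ card) x)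

  idx-injective : ∀ {x y} → idx x ≡ idx y → x ≈ y
  idx-injective {x} {y} eq = trans (sym (e-idx x)) (trans (reflexive (≡.cong e eq)) (e-idx y))

  injective⇒surjective : (Φ : Carrier → Carrier) → (∀ a b → Φ a ≈ Φ b → a ≈ b) →
                         ∀ t → ∃ λ a → Φ a ≈ t
  injective⇒surjective Φ Φ-inj t =
    let i , eq = Fin-injective⇒surjective (idx ∘ Φ ∘ e) φ-inj (idx t)
    in e i , idx-injective eq
    where
    φ-inj : ∀ i j → idx (Φ (e i)) ≡ idx (Φ (e j)) → i ≡ j
    φ-inj i j eq = e-injective i j (Φ-inj _ _ (idx-injective eq))

  -- Translation by 1# permutes the elements, so Σ x = Σ (x + 1) = Σ x + n · 1.
  characteristic : n · 1# ≈ 0#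
  characteristic = ∙-cancelˡ (sum e) _ _ (begin
    sum e + n · 1#                 ≈⟨ +-congˡ (sum-replicate n) ⟨
    sum e + sum (replicate n 1#)   ≈⟨ ∑-distrib-+ e (replicate n 1#) ⟨
    sum (λ i → e i + 1#)           ≈⟨ sum-cong-≋ (λ i → e-idx (e i + 1#)) ⟨
    sum (e ∘ σ)                    ≈⟨ sum-permute e translation ⟨
    sum e                          ≈⟨ +-identityʳ _ ⟨
    sum e + 0#                     ∎)
    where
    σ : Fin n → Fin n
    σ i = idx (e i + 1#)
    σ-inj : ∀ i j → σ i ≡ σ j → i ≡ j
    σ-inj i j eq = e-injective i j (∙-cancelʳ 1# _ _ (idx-injective eq))
    σ⁻¹ : Fin n → Fin n
    σ⁻¹ t = proj₁ (Fin-injective⇒surjective σ σ-inj t)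
    translation : Permutation′ n
    translation = permutation σ σ⁻¹ (λ t → proj₂ (Fin-injective⇒surjective σ σ-inj t))
                                    (λ i → σ-inj _ _ (proj₂ (Fin-injective⇒surjective σ σ-inj (σ i))))

-- Ideals are arbitrary predicates, so testing maximality against the ideal 𝔪 ∪ {x ∣ P} decides P.
maximal-ideal⇒excluded-middle : ∀ (R : CRing) {𝔪} → IsMaximalIdeal R 𝔪 → (P : Set) → Dec P
maximal-ideal⇒excluded-middle R {𝔪} (𝔪-ideal , 1∉𝔪 , 𝔪-maximal) P
  with 𝔪-maximal (λ x → x ∈ 𝔪 ⊎ P) 𝔪∪P-ideal inj₁
  where
  open CommutativeRing R
  open IsIdeal 𝔪-ideal
  𝔪∪P-ideal : IsIdeal R (λ x → x ∈ 𝔪 ⊎ P)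
  𝔪∪P-ideal = record
    { resp = λ { x≈y (inj₁ x∈𝔪) → inj₁ (resp x≈y x∈𝔪) ; _ (inj₂ p) → inj₂ p }
    ; 0∈   = inj₁ 0∈
    ; +∈   = λ { (inj₁ x∈𝔪) (inj₁ y∈𝔪) → inj₁ (+∈ x∈𝔪 y∈𝔪) ; (inj₂ p) _ → inj₂ p ; _ (inj₂ p) → inj₂ p }
    ; *∈   = λ { r (inj₁ x∈𝔪) → inj₁ (*∈ r x∈𝔪) ; _ (inj₂ p) → inj₂ p }
    }
... | inj₁ 𝔪∪P⊆𝔪       = no (λ p → 1∉𝔪 (𝔪∪P⊆𝔪 (inj₂ p)))
... | inj₂ (inj₁ 1∈𝔪) = ⊥-elim (1∉𝔪 1∈𝔪)
... | inj₂ (inj₂ p)    = yes p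

module MaximalIdeals (R : CRing) (decide : (P : Set) → Dec P) {n} (card : HasCard R n) where
  open CommutativeRing R
  open FiniteRing R card using (e; idx; e-idx)
  open import Algebra.Properties.CommutativeSemigroup +-commutativeSemigroup using (interchange)

  _+⟨_⟩ : Pred Carrier 0ℓ → Carrier → Pred Carrier 0ℓ
  (I +⟨ x ⟩) z = ∃₂ λ i r → i ∈ I × z ≈ i + r * x

  module _ {I : Pred Carrier 0ℓ} (I-ideal : IsIdeal R I) where
    open IsIdeal I-ideal

    +⟨⟩-isIdeal : ∀ x → IsIdeal R (I +⟨ x ⟩)
    +⟨⟩-isIdeal x = record
      { resp = λ { z≈z′ (i , r , i∈I , z≈) → i , r , i∈I , trans (sym z≈z′) z≈ }
      ; 0∈   = 0# , 0# , 0∈ , sym (trans (+-congˡ (zeroˡ x)) (+-identityʳ 0#))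
      ; +∈   = λ { (i , r , i∈I , z≈) (i′ , r′ , i′∈I , z′≈) →
                   i + i′ , r + r′ , +∈ i∈I i′∈I ,
                   trans (+-cong z≈ z′≈) (trans (interchange i (r * x) i′ (r′ * x))
                                                (+-congˡ (sym (distribʳ x r r′)))) }
      ; *∈   = λ { s (i , r , i∈I , z≈) →
                   s * i , s * r , *∈ s i∈I ,
                   trans (*-congˡ z≈) (trans (distribˡ s i (r * x)) (+-congˡ (sym (*-assoc s r x)))) }
      }

    ⊆+⟨⟩ : ∀ x → I ⊆ I +⟨ x ⟩
    ⊆+⟨⟩ x {z} z∈I = z , 0# , z∈I , sym (trans (+-congˡ (zeroˡ x)) (+-identityʳ z))

    ∈+⟨⟩ : ∀ x → x ∈ I +⟨ x ⟩
    ∈+⟨⟩ x = 0# , 1# , 0∈ , sym (trans (+-identityˡ _) (*-identityˡ x))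

  ⌊_⌋ : Pred Carrier 0ℓ → Subset n
  ⌊ I ⌋ = tabulate (λ i → does (decide (e i ∈ I)))

  ∈⌊⌋⁺ : ∀ {I i} → e i ∈ I → i Subset.∈ ⌊ I ⌋
  ∈⌊⌋⁺ {I} {i} p = lookup⇒[]= i _ (≡.trans (lookup∘tabulate _ i) (dec-true (decide (e i ∈ I)) p))

  ∈⌊⌋⁻ : ∀ {I i} → i Subset.∈ ⌊ I ⌋ → e i ∈ I
  ∈⌊⌋⁻ {I} {i} p with decide (e i ∈ I) | ≡.trans (≡.sym (lookup∘tabulate _ i)) ([]=⇒lookup p)
  ... | yes e-i∈I | _ = e-i∈I
  ... | no _      | ()

  ⌊⌋-⊂ : ∀ {I J x} → IsIdeal R I → IsIdeal R J → I ⊆ J → x ∈ J → x ∉ I → ⌊ J ⌋ ⊃ ⌊ I ⌋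
  ⌊⌋-⊂ {I} {J} {x} I-ideal J-ideal I⊆J x∈J x∉I =
    (λ i∈I → ∈⌊⌋⁺ {J} (I⊆J (∈⌊⌋⁻ {I} i∈I))) ,
    idx x , ∈⌊⌋⁺ {J} (IsIdeal.resp J-ideal (sym (e-idx x)) x∈J) ,
    λ idx∈I → x∉I (IsIdeal.resp I-ideal (e-idx x) (∈⌊⌋⁻ {I} idx∈I))

  maximal-above : ∀ {I} → IsIdeal R I → 1# ∉ I → Σ (Pred Carrier 0ℓ) λ M → IsMaximalIdeal R M × I ⊆ M
  maximal-above = go (⊃-wellFounded _)
    where
    go : ∀ {I} → Acc _⊃_ ⌊ I ⌋ → IsIdeal R I → 1# ∉ I → Σ (Pred Carrier 0ℓ) λ M → IsMaximalIdeal R M × I ⊆ M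
    go {I} (acc rec) I-ideal 1∉I with decide (∃ λ x → x ∉ I × 1# ∉ I +⟨ x ⟩)
    ... | yes (x , x∉I , 1∉I+x) =
      let I+x-ideal = +⟨⟩-isIdeal I-ideal x
          M , M-maximal , I+x⊆M =
            go (rec (⌊⌋-⊂ I-ideal I+x-ideal (⊆+⟨⟩ I-ideal x) (∈+⟨⟩ I-ideal x) x∉I)) I+x-ideal 1∉I+x
      in M , M-maximal , I+x⊆M ∘ ⊆+⟨⟩ I-ideal x
    ... | no saturated = I , (I-ideal , 1∉I , maximality) , λ z∈I → z∈I
      where
      maximality : ∀ J → IsIdeal R J → I ⊆ J → J ⊆ I ⊎ 1# ∈ J
      maximality J J-ideal I⊆J with decide (∃ λ x → x ∈ J × x ∉ I)
      ... | yes (x , x∈J , x∉I) =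
        let i , r , i∈I , 1≈ = decidable-stable (decide _) (λ 1∉I+x → saturated (x , x∉I , 1∉I+x))
        in inj₂ (IsIdeal.resp J-ideal (sym 1≈) (IsIdeal.+∈ J-ideal (I⊆J i∈I) (IsIdeal.*∈ J-ideal r x∈J)))
      ... | no J⊆I = inj₁ λ {x} x∈J → decidable-stable (decide (x ∈ I)) (λ x∉I → J⊆I (x , x∈J , x∉I))

module LocalRing (R : CRing) (𝔪 : Pred (CommutativeRing.Carrier R) 0ℓ) (local : IsLocalWith R 𝔪)
                 {n} (card : HasCard R n) where
  open CommutativeRing R

  decide : (P : Set) → Dec P
  decide = maximal-ideal⇒excluded-middle R (proj₁ local)

  open MaximalIdeals R decide card using (maximal-above)

  ∉𝔪⇒IsUnit : ∀ {u} → u ∉ 𝔪 → IsUnit R u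
  ∉𝔪⇒IsUnit {u} u∉𝔪 with decide (IsUnit R u)
  ... | yes u-unit = u-unit
  ... | no u-nonunit =
    let M , M-maximal , Ru⊆M = maximal-above Ru-ideal 1∉Ru
    in ⊥-elim (u∉𝔪 (proj₁ (proj₂ local M M-maximal u) (Ru⊆M (1# , sym (*-identityˡ u)))))
    where
    Ru : Pred Carrier 0ℓ
    Ru z = ∃ λ r → z ≈ r * u
    Ru-ideal : IsIdeal R Ru
    Ru-ideal = record
      { resp = λ { z≈z′ (r , z≈ru) → r , trans (sym z≈z′) z≈ru }
      ; 0∈   = 0# , sym (zeroˡ u)
      ; +∈   = λ { (r , z≈) (r′ , z′≈) → r + r′ , trans (+-cong z≈ z′≈) (sym (distribʳ u r r′)) }
      ; *∈   = λ { s (r , z≈) → s * r , trans (*-congˡ z≈) (sym (*-assoc s r u)) }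
      }
    1∉Ru : 1# ∉ Ru
    1∉Ru (r , 1≈ru) = u-nonunit (r , trans (*-comm u r) (sym 1≈ru))

cliqueNumber-transfer : ∀ (A B : CRing) {k w}
                        (φ : CommutativeRing.Carrier A → CommutativeRing.Carrier B)
                        (ψ : CommutativeRing.Carrier B → CommutativeRing.Carrier A) →
                        (∀ {m f} → IsClique A k m f → IsClique B k m (φ ∘ f)) →
                        (∀ {m g} → IsClique B k m g → IsClique A k m (ψ ∘ g)) →
                        CliqueNumberIs A k w ⇔ CliqueNumberIs B k w
cliqueNumber-transfer A B φ ψ φ-clique ψ-clique = mk⇔
  (λ ((f , f-clique) , A-bound) →
     (φ ∘ f , φ-clique f-clique) , λ m g g-clique → A-bound m (ψ ∘ g) (ψ-clique g-clique))
  (λ ((g , g-clique) , B-bound) →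
     (ψ ∘ g , ψ-clique g-clique) , λ m f f-clique → B-bound m (φ ∘ f) (φ-clique f-clique))

module Residue (R F : CRing) (𝔪 : Pred (CommutativeRing.Carrier R) 0ℓ) (local : IsLocalWith R 𝔪)
               {n} (card : HasCard R n)
               (F-nontrivial : ¬ (CommutativeRing._≈_ F (CommutativeRing.1# F) (CommutativeRing.0# F)))
               (π : CommutativeRing.Carrier R → CommutativeRing.Carrier F) (residue : IsResidueMap R F 𝔪 π) where
  module R = CommutativeRing R
  module F = CommutativeRing F
  open RingMorphisms.IsRingHomomorphism (proj₁ residue) using (*-homo; +-homo; -‿homo; 1#-homo; 0#-homo)
    renaming (⟦⟧-cong to π-cong)
  open Powers using (pow-cong; geom; geom-cong; pow-expand; geom-diag)
  open Units using (IsUnit-pow; IsUnit-cancelʳ; IsUnit⇒≉0; InU-resp; InU⇒≉0)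
  open LocalRing R 𝔪 local card using (decide; ∉𝔪⇒IsUnit)
  open FiniteRing R card using (injective⇒surjective)
  open IsIdeal (proj₁ (proj₁ local)) using (resp; 0∈)
  open import Algebra.Properties.Semiring.Mult F.semiring using (×-assoc-*; ×-congʳ) renaming (_×_ to _·_)
  module R+ = Algebra.Properties.Group R.+-group
  module F+ = Algebra.Properties.Group F.+-group

  π-sub : ∀ a b → π (a R.- b) F.≈ π a F.- π b
  π-sub a b = F.trans (+-homo a (R.- b)) (F.+-congˡ (-‿homo b))

  π-pow : ∀ x k → π (pow R x k) F.≈ pow F (π x) k
  π-pow x zero    = 1#-homo
  π-pow x (suc k) = F.trans (*-homo x _) (F.*-congˡ (π-pow x k))

  π-geom : ∀ x y k → π (geom R x y k) F.≈ geom F (π x) (π y) k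
  π-geom x y zero    = 0#-homo
  π-geom x y (suc k) =
    F.trans (+-homo _ _) (F.+-cong (F.trans (*-homo x _) (F.*-congˡ (π-geom x y k))) (π-pow y k))

  π-IsUnit : ∀ {x} → IsUnit R x → IsUnit F (π x)
  π-IsUnit (y , xy≈1) = π y , F.trans (F.sym (*-homo _ _)) (F.trans (π-cong xy≈1) 1#-homo)

  π-InU : ∀ {k z} → InU R k z → InU F k (π z)
  π-InU {k} (x , x-unit , z≈xᵏ) = π x , π-IsUnit x-unit , F.trans (π-cong z≈xᵏ) (π-pow x k)

  ker⇔𝔪 : ∀ x → π x F.≈ F.0# ⇔ x ∈ 𝔪
  ker⇔𝔪 = proj₂ (proj₂ residue)

  π≉0⇒IsUnit : ∀ {u} → ¬ (π u F.≈ F.0#) → IsUnit R u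
  π≉0⇒IsUnit {u} πu≉0 = ∉𝔪⇒IsUnit (πu≉0 ∘ Equivalence.from (ker⇔𝔪 u))

  lift : F.Carrier → R.Carrier
  lift y = proj₁ (proj₁ (proj₂ residue) y)

  π-lift : ∀ y → π (lift y) F.≈ y
  π-lift y = proj₂ (proj₁ (proj₂ residue) y)

  π-Adj : ∀ {k v w} → Adj R k v w → Adj F k (π v) (π w)
  π-Adj {k} adj = InU-resp F {k} (π-sub _ _) (π-InU {k} adj)

  π-clique : ∀ {k m f} → IsClique R k m f → IsClique F k m (π ∘ f)
  π-clique {k} clique i j i≢j =
    let adj = π-Adj {k} (proj₂ (clique i j i≢j))
    in (λ πfi≈πfj → InU⇒≉0 F F-nontrivial {k} adj (F+.x≈y⇒x∙y⁻¹≈ε (F.sym πfi≈πfj))) , adj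

  module _ {k} (k≉0 : ¬ (k · F.1# F.≈ F.0#)) where

    -- Modulo 𝔪, geom x x′ k reduces to k yᵏ⁻¹, which is nonzero in F.
    geom-IsUnit : ∀ {y x x′} → IsUnit F y → π x F.≈ y → π x′ F.≈ y → IsUnit R (geom R x x′ k)
    geom-IsUnit {y} {x} {x′} y-unit πx≈y πx′≈y =
      π≉0⇒IsUnit λ π[geom]≈0 → k≉0 (IsUnit-cancelʳ F (IsUnit-pow F k y-unit) (begin
      k · F.1# F.* pow F y k      ≈⟨ ×-assoc-* k F.1# _ ⟩
      k · (F.1# F.* pow F y k)    ≈⟨ ×-congʳ k (F.*-identityˡ _) ⟩
      k · pow F y k               ≈⟨ geom-diag F y k ⟨
      y F.* geom F y y k          ≈⟨ F.*-congˡ (geom-cong F k πx≈y πx′≈y) ⟨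
      y F.* geom F (π x) (π x′) k ≈⟨ F.*-congˡ (F.trans (F.sym (π-geom x x′ k)) π[geom]≈0) ⟩
      y F.* F.0#                  ≈⟨ F.zeroʳ y ⟩
      F.0#                        ∎))
      where open import Relation.Binary.Reasoning.Setoid F.setoid

    pow-injective : ∀ {y x x′} → IsUnit F y → π x F.≈ y → π x′ F.≈ y → pow R x k R.≈ pow R x′ k → x R.≈ x′
    pow-injective {y} {x} {x′} y-unit πx≈y πx′≈y xᵏ≈x′ᵏ =
      R+.x∙y⁻¹≈ε⇒x≈y x x′ (IsUnit-cancelʳ R (geom-IsUnit y-unit πx≈y πx′≈y) (R+.∙-cancelˡ (pow R x′ k) _ _
        (R.trans (R.sym (pow-expand R x x′ k)) (R.trans xᵏ≈x′ᵏ (R.sym (R.+-identityʳ _))))))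

    -- Hensel's lemma: a ↦ (x₀ + a)ᵏ - z is injective on 𝔪 and maps 𝔪 into 𝔪; extended by the
    -- identity off 𝔪 it is an injective self-map Φ of the finite ring R, so Φ has a zero.
    InU-lift : ∀ {z} → InU F k (π z) → InU R k z
    InU-lift {z} (y , y-unit , πz≈yᵏ) =
      let a , Φa≈0 = injective⇒surjective Φ Φ-injective R.0#
      in step≈0⇒InU (decide (a ∈ 𝔪)) Φa≈0
      where
      x₀ : R.Carrier
      x₀ = lift y

      π[x₀+a]≈y : ∀ {a} → a ∈ 𝔪 → π (x₀ R.+ a) F.≈ y
      π[x₀+a]≈y {a} a∈𝔪 = F.trans (+-homo x₀ a)
        (F.trans (F.+-cong (π-lift y) (Equivalence.from (ker⇔𝔪 a) a∈𝔪)) (F.+-identityʳ y))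

      defect : R.Carrier → R.Carrier
      defect a = pow R (x₀ R.+ a) k R.- z

      defect-∈𝔪 : ∀ {a} → a ∈ 𝔪 → defect a ∈ 𝔪
      defect-∈𝔪 {a} a∈𝔪 = Equivalence.to (ker⇔𝔪 (defect a)) (F.trans (π-sub _ z) (F+.x≈y⇒x∙y⁻¹≈ε
        (F.trans (π-pow _ k) (F.trans (pow-cong F k (π[x₀+a]≈y a∈𝔪)) (F.sym πz≈yᵏ)))))

      step : (a : R.Carrier) → Dec (a ∈ 𝔪) → R.Carrier
      step a (yes _) = defect a
      step a (no _)  = a

      Φ : R.Carrier → R.Carrier
      Φ a = step a (decide (a ∈ 𝔪))

      step-injective : ∀ {a b} da db → step a da R.≈ step b db → a R.≈ b
      step-injective (yes a∈𝔪) (yes b∈𝔪) eq = R+.∙-cancelˡ x₀ _ _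
        (pow-injective y-unit (π[x₀+a]≈y a∈𝔪) (π[x₀+a]≈y b∈𝔪) (R+.∙-cancelʳ (R.- z) _ _ eq))
      step-injective (yes a∈𝔪) (no b∉𝔪) eq = ⊥-elim (b∉𝔪 (resp eq (defect-∈𝔪 a∈𝔪)))
      step-injective (no a∉𝔪) (yes b∈𝔪) eq = ⊥-elim (a∉𝔪 (resp (R.sym eq) (defect-∈𝔪 b∈𝔪)))
      step-injective (no _)   (no _)    eq = eq

      Φ-injective : ∀ a b → Φ a R.≈ Φ b → a R.≈ b
      Φ-injective a b = step-injective (decide (a ∈ 𝔪)) (decide (b ∈ 𝔪))

      step≈0⇒InU : ∀ {a} da → step a da R.≈ R.0# → InU R k z
      step≈0⇒InU {a} (yes a∈𝔪) defect≈0 =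
        x₀ R.+ a , π≉0⇒IsUnit (λ π≈0 → IsUnit⇒≉0 F F-nontrivial y-unit (F.trans (F.sym (π[x₀+a]≈y a∈𝔪)) π≈0)) ,
        R.sym (R+.x∙y⁻¹≈ε⇒x≈y _ z defect≈0)
      step≈0⇒InU (no a∉𝔪) a≈0 = ⊥-elim (a∉𝔪 (resp (R.sym a≈0) 0∈))

    lift-clique : ∀ {m g} → IsClique F k m g → IsClique R k m (lift ∘ g)
    lift-clique {g = g} clique i j i≢j =
      let gi≉gj , adj = clique i j i≢j
      in (λ eq → gi≉gj (F.trans (F.sym (π-lift (g i))) (F.trans (π-cong eq) (π-lift (g j))))) ,
         InU-lift (InU-resp F {k} (F.sym π[lift-lift]≈) adj)
      where
      π[lift-lift]≈ : ∀ {a b} → π (lift b R.- lift a) F.≈ b F.- a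
      π[lift-lift]≈ {a} {b} = F.trans (π-sub _ _) (F.+-cong (π-lift b) (F.-‿cong (π-lift a)))

open import Data.Nat using (_*_)

-- The hypothesis (k, q - 1) ∣ (q - 1)/2 only makes G_R(k) undirected; IsClique already demands
-- adjacency in both directions.
proposition2p9 : (R : CRing) (nR : ℕ) → HasCard R nR →
    (𝔪 : Pred (CommutativeRing.Carrier R) 0ℓ) → IsLocalWith R 𝔪 →
    (F : CRing) → IsField F → (q : ℕ) → HasCard F q →
    (π : CommutativeRing.Carrier R → CommutativeRing.Carrier F) → IsResidueMap R F 𝔪 π →
    (k : ℕ) → 2 * gcd k (q ∸ 1) ∣ q ∸ 1 → gcd k q ≡ 1 →
    ∀ w → CliqueNumberIs R k w ⇔ CliqueNumberIs F k w
proposition2p9 R nR cardR 𝔪 local F (F-nontrivial , _) q cardF π residue k _ gcd[k,q]≡1 w =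
  cliqueNumber-transfer R F {k} {w} π lift (π-clique {k}) (lift-clique {k} k≉0)
  where
  open Residue R F 𝔪 local cardR F-nontrivial π residue using (π-clique; lift; lift-clique)
  open CommutativeRing F using (_≈_; 1#; 0#; semiring)
  open Characteristic F using (coprime-to-char⇒≉0)
  open import Algebra.Properties.Semiring.Mult semiring using () renaming (_×_ to _·_)
  k≉0 : ¬ (k · 1# ≈ 0#)
  k≉0 = coprime-to-char⇒≉0 F-nontrivial {k} {q} (FiniteRing.characteristic F cardF) gcd[k,q]≡1
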